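{- Let $G$ be a simple graph and let $F$ be the mixed graph obtained from $G$ by replacing each edge $uv$ with $d_G(u)>d_G(v)$ by the arc $\overrightarrow{uv}$ and keeping each edge $uv$ with $d_G(u)=d_G(v)$ as an undirected edge. Let $X$ be the set of vertices $x$ with $d_F^+(x) \geq d_F^-(x)$. If $u,v \in X$ are distinct and $uv \notin E(G)$, then $cM_{2}(G+uv) \geq cM_{2}(G)$; moreover, if equality holds then $d_G(u)=d_G(v)$, $d_F^+(u)=d_F^-(u)$ and $d_F^+(v)=d_F^-(v)$.
   Context: All graphs are finite and simple. $cM_{2}(G)=\sum_{uv \in E(G)} |d_{G}(u)^{2}-d_{G}(v)^{2}|$, where $d_G$ is the degree in $G$. In the mixed graph $F$, $d_F^+(x)$ is the number of arcs with tail $x$ and $d_F^-(x)$ is the number of arcs with head $x$ (undirected edges are not counted in either). $G+uv$ is the graph obtained by adding the edge $uv$. -}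

module Defs where

open import Data.Nat using (ℕ; zero; suc; _+_; _*_; _<ᵇ_; ∣_-_∣)
open import Data.Bool using (Bool; true; false; _∧_; _∨_; if_then_else_)
open import Data.Bool.Properties using (∨-comm)
open import Data.Fin using (Fin; toℕ; _≟_)
open import Relation.Binary.PropositionalEquality using (_≡_; _≢_; refl; cong₂; trans)
open import Relation.Nullary using (yes; no)
open import Data.Empty using (⊥-elim)
open import Relation.Nullary.Decidable using (⌊_⌋)

sumFin : (n : ℕ) → (Fin n → ℕ) → ℕ
sumFin zero    f = 0
sumFin (suc n) f = f Fin.zero + sumFin n (λ i → f (Fin.suc i))

countFin : (n : ℕ) → (Fin n → Bool) → ℕ
countFin n p = sumFin n (λ i → if p i then 1 else 0)

record SimpleGraph (n : ℕ) : Set where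
  field
    adj   : Fin n → Fin n → Bool
    sym   : ∀ u v → adj u v ≡ adj v u
    loopless : ∀ u → adj u u ≡ false
open SimpleGraph public

deg : ∀ {n} → SimpleGraph n → Fin n → ℕ
deg {n} G u = countFin n (λ v → adj G u v)

cM2 : ∀ {n} → SimpleGraph n → ℕ
cM2 {n} G = sumFin n λ u → sumFin n λ v →
  if adj G u v ∧ (toℕ u <ᵇ toℕ v)
  then ∣ deg G u * deg G u - deg G v * deg G v ∣
  else 0

-- In the mixed graph F: an arc x→y for each edge xy with d_G(x) > d_G(y).
-- d_F⁺(x) = number of neighbours y with d_G(y) < d_G(x).
outDeg : ∀ {n} → SimpleGraph n → Fin n → ℕ
outDeg {n} G x = countFin n (λ y → adj G x y ∧ (deg G y <ᵇ deg G x))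

inDeg : ∀ {n} → SimpleGraph n → Fin n → ℕ
inDeg {n} G x = countFin n (λ y → adj G x y ∧ (deg G x <ᵇ deg G y))

Adjacent : ∀ {n} → SimpleGraph n → Fin n → Fin n → Set
Adjacent G u v = adj G u v ≡ true

isUV : ∀ {n} → Fin n → Fin n → Fin n → Fin n → Bool
isUV u v x y = (⌊ x ≟ u ⌋ ∧ ⌊ y ≟ v ⌋) ∨ (⌊ x ≟ v ⌋ ∧ ⌊ y ≟ u ⌋)

isUV-sym : ∀ {n} (u v x y : Fin n) → isUV u v x y ≡ isUV u v y x
isUV-sym u v x y = trans (∨-comm (⌊ x ≟ u ⌋ ∧ ⌊ y ≟ v ⌋) _)
  (cong₂ _∨_ (∧-comm' ⌊ x ≟ v ⌋ ⌊ y ≟ u ⌋) (∧-comm' ⌊ x ≟ u ⌋ ⌊ y ≟ v ⌋))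
  where
  ∧-comm' : ∀ a b → (a ∧ b) ≡ (b ∧ a)
  ∧-comm' false false = refl
  ∧-comm' false true = refl
  ∧-comm' true false = refl
  ∧-comm' true true = refl

isUV-irr : ∀ {n} (u v x : Fin n) → u ≢ v → isUV u v x x ≡ false
isUV-irr u v x u≢v with x ≟ u | x ≟ v
... | yes refl | yes refl = ⊥-elim (u≢v refl)
... | yes _ | no _ = refl
... | no _ | yes _ = refl
... | no _ | no _ = refl

addEdge : ∀ {n} (G : SimpleGraph n) (u v : Fin n) → u ≢ v → SimpleGraph n
addEdge G u v u≢v = record
  { adj = λ x y → adj G x y ∨ isUV u v x y
  ; sym = λ x y → cong₂ _∨_ (SimpleGraph.sym G x y) (isUV-sym u v x y)
  ; loopless = λ x → cong₂ _∨_ (loopless G x) (isUV-irr u v x u≢v)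
  }

{-# OPTIONS --safe #-}
module Submission where

-- Counting every edge in both directions, 2·cM₂(G) = Σ_{x ~ y} |d(x)² − d(y)²|.  Adding uv raises
-- d(u) from a to a + 1 and d(v) from b to b + 1; raise them one vertex at a time.  Raising the value
-- at z from a to a + 1 lowers |a² − c²| by 2a + 1 for each neighbour with c > a (an arc of F into z)
-- and raises it by 2a + 1 for each other neighbour, so z gains (2a + 1)(#{c ≤ a} − d⁻(z)) ≥
-- (2a + 1)(d⁺(z) − d⁻(z)) ≥ 0; the new edge adds |(a + 1)² − (b + 1)²|.  Kept in ℕ, this is the
-- balance cM₂(G + uv) + Σ losses = cM₂(G) + Σ gains + |(a + 1)² − (b + 1)²|, and equality forces
-- a = b and #{c ≤ a} = d⁻ at u and v, which squeezes d⁺ = d⁻ there.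

open import Defs hiding (sym)
open import Data.Bool using (Bool; true; false; _∧_; _∨_; not; if_then_else_)
open import Data.Fin using (Fin; toℕ; _≟_)
open import Data.Fin.Properties using (toℕ-injective)
open import Data.List using (_∷_; [])
open import Data.Nat using (ℕ; zero; suc; _+_; _*_; _≤_; _≥_; _<ᵇ_; z≤n; ∣_-_∣)
open import Data.Nat.Properties hiding (_≟_)
open import Data.Nat.Tactic.RingSolver using (solve-∀; solve)
open import Data.Product using (_×_; _,_; proj₁; proj₂)
open import Function using (_∘_)
open import Relation.Binary.Definitions using (tri<; tri≈; tri>)
open import Relation.Binary.PropositionalEquality
open import Relation.Nullary using (¬_; yes; no)
open import Relation.Nullary.Decidable using (⌊_⌋; ⌊⌋-map′)
open import Relation.Nullary.Negation using (contradiction)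
open import Relation.Nullary.Reflects using (ofʸ; ofⁿ)

open import Algebra.Properties.CommutativeMonoid.Sum +-0-commutativeMonoid
  using (∑-distrib-+; ∑-comm; sum-cong-≗; sum-replicate-zero) renaming (sum to ∑)

-- Sums over Fin

sumFin≡∑ : ∀ n (f : Fin n → ℕ) → sumFin n f ≡ ∑ f
sumFin≡∑ zero    f = refl
sumFin≡∑ (suc n) f = cong (f Fin.zero +_) (sumFin≡∑ n (λ i → f (Fin.suc i)))

sumFin-cong : ∀ n {f g : Fin n → ℕ} → (∀ i → f i ≡ g i) → sumFin n f ≡ sumFin n g
sumFin-cong n {f} {g} f≗g = begin
  sumFin n f  ≡⟨ sumFin≡∑ n f ⟩
  ∑ f         ≡⟨ sum-cong-≗ f≗g ⟩
  ∑ g         ≡⟨ sumFin≡∑ n g ⟨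
  sumFin n g  ∎
  where open ≡-Reasoning

sumFin-distrib-+ : ∀ n (f g : Fin n → ℕ) →
                   sumFin n (λ i → f i + g i) ≡ sumFin n f + sumFin n g
sumFin-distrib-+ n f g = begin
  sumFin n (λ i → f i + g i)  ≡⟨ sumFin≡∑ n _ ⟩
  ∑ (λ i → f i + g i)         ≡⟨ ∑-distrib-+ f g ⟩
  ∑ f + ∑ g                   ≡⟨ cong₂ _+_ (sumFin≡∑ n f) (sumFin≡∑ n g) ⟨
  sumFin n f + sumFin n g     ∎
  where open ≡-Reasoning

sumFin-comm : ∀ m n (f : Fin m → Fin n → ℕ) →
              sumFin m (λ x → sumFin n (f x)) ≡ sumFin n (λ y → sumFin m (λ x → f x y))
sumFin-comm m n f = begin
  sumFin m (λ x → sumFin n (f x))          ≡⟨ sumFin≡∑ m _ ⟩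
  ∑ (λ x → sumFin n (f x))                 ≡⟨ sum-cong-≗ (λ x → sumFin≡∑ n (f x)) ⟩
  ∑ (λ x → ∑ (f x))                        ≡⟨ ∑-comm f ⟩
  ∑ (λ y → ∑ (λ x → f x y))                ≡⟨ sum-cong-≗ (λ y → sumFin≡∑ m (λ x → f x y)) ⟨
  ∑ (λ y → sumFin m (λ x → f x y))         ≡⟨ sumFin≡∑ n _ ⟨
  sumFin n (λ y → sumFin m (λ x → f x y))  ∎
  where open ≡-Reasoning

sumFin-zero : ∀ n → sumFin n (λ _ → 0) ≡ 0
sumFin-zero n = trans (sumFin≡∑ n _) (sum-replicate-zero n)

sumFin-mono-≤ : ∀ n {f g : Fin n → ℕ} → (∀ i → f i ≤ g i) → sumFin n f ≤ sumFin n g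
sumFin-mono-≤ zero    f≤g = z≤n
sumFin-mono-≤ (suc n) f≤g = +-mono-≤ (f≤g Fin.zero) (sumFin-mono-≤ n (λ i → f≤g (Fin.suc i)))

countFin-mono : ∀ n {p q : Fin n → Bool} → (∀ i → p i ≡ true → q i ≡ true) → countFin n p ≤ countFin n q
countFin-mono n {p} {q} p⇒q = sumFin-mono-≤ n indicator-mono
  where
  indicator-mono : ∀ i → (if p i then 1 else 0) ≤ (if q i then 1 else 0)
  indicator-mono i with p i | p⇒q i
  ... | true  | pi⇒qi rewrite pi⇒qi refl = ≤-refl
  ... | false | _ = z≤n

sumFin-if-const : ∀ n (p : Fin n → Bool) k → sumFin n (λ i → if p i then k else 0) ≡ k * countFin n p
sumFin-if-const zero    p k = sym (*-zeroʳ k)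
sumFin-if-const (suc n) p k with p Fin.zero
... | true  = trans (cong (k +_) (sumFin-if-const n (λ i → p (Fin.suc i)) k)) (sym (*-suc k _))
... | false = sumFin-if-const n (λ i → p (Fin.suc i)) k

sumFin-if-outer : ∀ n b (f : Fin n → ℕ) → sumFin n (λ i → if b then f i else 0) ≡ (if b then sumFin n f else 0)
sumFin-if-outer n true  f = refl
sumFin-if-outer n false f = sumFin-zero n

sumFin-if-≟ : ∀ n (z : Fin n) (g : Fin n → ℕ) → sumFin n (λ x → if ⌊ x ≟ z ⌋ then g x else 0) ≡ g z
sumFin-if-≟ (suc n) Fin.zero    g = trans (cong (g Fin.zero +_) (sumFin-zero n)) (+-identityʳ _)
sumFin-if-≟ (suc n) (Fin.suc z) g = trans
  (sumFin-cong n (λ i → cong (λ b → if b then g (Fin.suc i) else 0) (⌊⌋-map′ _ _ (i ≟ z))))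
  (sumFin-if-≟ n z (λ i → g (Fin.suc i)))

sumFin-if-∧-≟ : ∀ n b (z : Fin n) (g : Fin n → ℕ) →
                sumFin n (λ y → if b ∧ ⌊ y ≟ z ⌋ then g y else 0) ≡ (if b then g z else 0)
sumFin-if-∧-≟ n true  z g = sumFin-if-≟ n z g
sumFin-if-∧-≟ n false z g = sumFin-zero n

if-∧ : ∀ a b (t : ℕ) → (if a ∧ b then t else 0) ≡ (if b then (if a then t else 0) else 0)
if-∧ true  b     t = refl
if-∧ false true  t = refl
if-∧ false false t = refl

if-∨-disjoint : ∀ a b t → (a ≡ true → b ≡ false) →
                (if a ∨ b then t else 0) ≡ (if a then t else 0) + (if b then t else 0)
if-∨-disjoint true  b t a⇒¬b rewrite a⇒¬b refl = sym (+-identityʳ t)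
if-∨-disjoint false b t a⇒¬b = refl

sumFin-if-∨ : ∀ n (p q : Fin n → Bool) (f : Fin n → ℕ) → (∀ i → p i ≡ true → q i ≡ false) →
              sumFin n (λ i → if p i ∨ q i then f i else 0)
              ≡ sumFin n (λ i → if p i then f i else 0) + sumFin n (λ i → if q i then f i else 0)
sumFin-if-∨ n p q f disjoint = trans (sumFin-cong n (λ i → if-∨-disjoint (p i) (q i) (f i) (disjoint i)))
                                     (sumFin-distrib-+ n _ _)

countFin-∧-cong : ∀ n {p q q′ : Fin n → Bool} → (∀ i → p i ≡ true → q i ≡ q′ i) →
                  countFin n (λ i → p i ∧ q i) ≡ countFin n (λ i → p i ∧ q′ i)
countFin-∧-cong n {p} {q} {q′} q≡q′ = sumFin-cong n pointwise
  where
  pointwise : ∀ i → (if p i ∧ q i then 1 else 0) ≡ (if p i ∧ q′ i then 1 else 0)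
  pointwise i with p i | q≡q′ i
  ... | true  | qi≡q′i = cong (λ b → if b then 1 else 0) (qi≡q′i refl)
  ... | false | _      = refl

sumFin²-distrib-+ : ∀ n (f g : Fin n → Fin n → ℕ) →
                    sumFin n (λ x → sumFin n (λ y → f x y + g x y))
                    ≡ sumFin n (λ x → sumFin n (f x)) + sumFin n (λ x → sumFin n (g x))
sumFin²-distrib-+ n f g = trans (sumFin-cong n (λ x → sumFin-distrib-+ n (f x) (g x))) (sumFin-distrib-+ n _ _)

sumFin²-star : ∀ n (z : Fin n) (g : Fin n → ℕ) →
               sumFin n (λ x → sumFin n (λ y → (if ⌊ x ≟ z ⌋ then g y else 0) + (if ⌊ y ≟ z ⌋ then g x else 0)))
               ≡ 2 * sumFin n g
sumFin²-star n z g = begin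
  sumFin n (λ x → sumFin n (λ y → (if ⌊ x ≟ z ⌋ then g y else 0) + (if ⌊ y ≟ z ⌋ then g x else 0)))
    ≡⟨ sumFin²-distrib-+ n _ _ ⟩
  sumFin n (λ x → sumFin n (λ y → if ⌊ x ≟ z ⌋ then g y else 0))
    + sumFin n (λ x → sumFin n (λ y → if ⌊ y ≟ z ⌋ then g x else 0))
    ≡⟨ cong₂ _+_ (trans (sumFin-cong n (λ x → sumFin-if-outer n ⌊ x ≟ z ⌋ g)) (sumFin-if-≟ n z _))
                 (sumFin-cong n (λ x → sumFin-if-≟ n z (λ _ → g x))) ⟩
  sumFin n g + sumFin n g
    ≡⟨ cong (sumFin n g +_) (+-identityʳ _) ⟨
  2 * sumFin n g ∎
  where open ≡-Reasoning

split-at-diagonal : ∀ {n} (x y : Fin n) t → (x ≡ y → t ≡ 0) →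
                    (if toℕ x <ᵇ toℕ y then t else 0) + (if toℕ y <ᵇ toℕ x then t else 0) ≡ t
split-at-diagonal x y t diagonal
  with toℕ x <ᵇ toℕ y | <ᵇ-reflects-< (toℕ x) (toℕ y) | toℕ y <ᵇ toℕ x | <ᵇ-reflects-< (toℕ y) (toℕ x)
... | true  | ofʸ x<y | true  | ofʸ y<x = contradiction y<x (<-asym x<y)
... | true  | _       | false | _       = +-identityʳ t
... | false | _       | true  | _       = refl
... | false | ofⁿ x≮y | false | ofⁿ y≮x =
  sym (diagonal (toℕ-injective (≤-antisym (≮⇒≥ y≮x) (≮⇒≥ x≮y))))

upperTriangle-double : ∀ n (f : Fin n → Fin n → ℕ) → (∀ x y → f x y ≡ f y x) → (∀ x → f x x ≡ 0) →
                       2 * sumFin n (λ x → sumFin n (λ y → if toℕ x <ᵇ toℕ y then f x y else 0))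
                       ≡ sumFin n (λ x → sumFin n (f x))
upperTriangle-double n f f-sym f-diag = begin
  2 * upper                                                     ≡⟨ cong (upper +_) (+-identityʳ upper) ⟩
  upper + upper                                                 ≡⟨ cong (upper +_) upper≡lower ⟩
  upper + sumFin n (λ x → sumFin n (λ y → below x y))           ≡⟨ sumFin²-distrib-+ n above below ⟨
  sumFin n (λ x → sumFin n (λ y → above x y + below x y))       ≡⟨ sumFin-cong n (λ x → sumFin-cong n (split x)) ⟩
  sumFin n (λ x → sumFin n (f x))                               ∎
  where
  open ≡-Reasoning
  above below : Fin n → Fin n → ℕ
  above x y = if toℕ x <ᵇ toℕ y then f x y else 0
  below x y = if toℕ y <ᵇ toℕ x then f x y else 0
  upper : ℕ
  upper = sumFin n (λ x → sumFin n (above x))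
  split : ∀ x y → above x y + below x y ≡ f x y
  split x y = split-at-diagonal x y (f x y) λ { refl → f-diag x }
  upper≡lower : upper ≡ sumFin n (λ x → sumFin n (below x))
  upper≡lower = trans (sumFin-comm n n above)
    (sumFin-cong n (λ x → sumFin-cong n (λ y → cong (λ t → if toℕ y <ᵇ toℕ x then t else 0) (f-sym y x))))

-- Squares and balances in ℕ

sqGap : ℕ → ℕ → ℕ
sqGap m n = ∣ m * m - n * n ∣

sqGap-comm : ∀ m n → sqGap m n ≡ sqGap n m
sqGap-comm m n = ∣-∣-comm (m * m) (n * n)

suc-square : ∀ a → suc a * suc a ≡ a * a + suc (a + a)
suc-square = solve-∀

∣m+s-n∣+s≡∣m-n∣ : ∀ {m s n} → m + s ≤ n → ∣ m + s - n ∣ + s ≡ ∣ m - n ∣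
∣m+s-n∣+s≡∣m-n∣ {m} {s} m+s≤n with m≤n⇒∃[o]m+o≡n m+s≤n
... | t , refl rewrite ∣m-m+n∣≡n (m + s) t | +-assoc m s t | ∣m-m+n∣≡n m (s + t) = +-comm t s

∣m+s-n∣≡∣m-n∣+s : ∀ {m s n} → n ≤ m → ∣ m + s - n ∣ ≡ ∣ m - n ∣ + s
∣m+s-n∣≡∣m-n∣+s {s = s} {n} n≤m with m≤n⇒∃[o]m+o≡n n≤m
... | t , refl rewrite +-assoc n t s | ∣-∣-comm (n + (t + s)) n | ∣-∣-comm (n + t) n
                      | ∣m-m+n∣≡n n (t + s) | ∣m-m+n∣≡n n t = refl

sqGap-suc : ∀ a c → sqGap (suc a) c + (if a <ᵇ c then suc (a + a) else 0)
                    ≡ sqGap a c + (if not (a <ᵇ c) then suc (a + a) else 0)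
sqGap-suc a c with a <ᵇ c | <ᵇ-reflects-< a c
... | true  | ofʸ a<c = begin
  ∣ suc a * suc a - c * c ∣ + suc (a + a)         ≡⟨ cong (λ m → ∣ m - c * c ∣ + suc (a + a)) (suc-square a) ⟩
  ∣ a * a + suc (a + a) - c * c ∣ + suc (a + a)   ≡⟨ ∣m+s-n∣+s≡∣m-n∣ {a * a} (subst (_≤ c * c) (suc-square a) [1+a]²≤c²) ⟩
  sqGap a c                                       ≡⟨ +-identityʳ _ ⟨
  sqGap a c + 0                                   ∎
  where
  open ≡-Reasoning
  [1+a]²≤c² : suc a * suc a ≤ c * c
  [1+a]²≤c² = *-mono-≤ a<c a<c
... | false | ofⁿ a≮c = begin
  ∣ suc a * suc a - c * c ∣ + 0                   ≡⟨ +-identityʳ _ ⟩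
  ∣ suc a * suc a - c * c ∣                       ≡⟨ cong (λ m → ∣ m - c * c ∣) (suc-square a) ⟩
  ∣ a * a + suc (a + a) - c * c ∣                 ≡⟨ ∣m+s-n∣≡∣m-n∣+s {a * a} (*-mono-≤ (≮⇒≥ a≮c) (≮⇒≥ a≮c)) ⟩
  sqGap a c + suc (a + a)                         ∎
  where open ≡-Reasoning

edge-sqGap-suc : ∀ e a c → (if e then sqGap (suc a) c else 0) + (if e ∧ (a <ᵇ c) then suc (a + a) else 0)
                           ≡ (if e then sqGap a c else 0) + (if e ∧ not (a <ᵇ c) then suc (a + a) else 0)
edge-sqGap-suc true  a c = sqGap-suc a c
edge-sqGap-suc false a c = refl

sqGap≡0⇒≡ : ∀ {m n} → sqGap m n ≡ 0 → m ≡ n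
sqGap≡0⇒≡ {m} {n} gap≡0 with <-cmp m n | ∣m-n∣≡0⇒m≡n gap≡0
... | tri< m<n _ _ | m²≡n² = contradiction m²≡n² (<⇒≢ (*-mono-< m<n m<n))
... | tri≈ _ m≡n _ | _     = m≡n
... | tri> _ _ n<m | m²≡n² = contradiction (sym m²≡n²) (<⇒≢ (*-mono-< n<m n<m))

<ᵇ-asym : ∀ m n → (m <ᵇ n) ≡ true → not (n <ᵇ m) ≡ true
<ᵇ-asym m n with m <ᵇ n | <ᵇ-reflects-< m n | n <ᵇ m | <ᵇ-reflects-< n m
... | true  | ofʸ m<n | true  | ofʸ n<m = λ _ → contradiction n<m (<-asym m<n)
... | _     | _       | false | _       = λ _ → refl
... | false | _       | true  | _       = λ ()

balance⇒≤ : ∀ {p p′ s s′ w} → p′ + s ≡ p + (s′ + w) → s ≤ s′ → p ≤ p′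
balance⇒≤ {p} {p′} {s} {s′} {w} balance s≤s′ =
  +-cancelʳ-≤ s p p′ (≤-trans (+-monoʳ-≤ p (≤-trans s≤s′ (m≤m+n s′ w))) (≤-reflexive (sym balance)))

balance⇒≡ : ∀ {p p′ s s′ w} → p′ + s ≡ p + (s′ + w) → s ≤ s′ → p′ ≡ p → w ≡ 0 × s ≡ s′
balance⇒≡ {p} {s = s} {s′} {w} balance s≤s′ refl = w≡0 , trans s≡s′+w (trans (cong (s′ +_) w≡0) (+-identityʳ s′))
  where
  s≡s′+w : s ≡ s′ + w
  s≡s′+w = +-cancelˡ-≡ p s (s′ + w) balance
  w≡0 : w ≡ 0
  w≡0 = n≤0⇒n≡0 (+-cancelˡ-≤ s′ w 0 (begin
    s′ + w  ≡⟨ s≡s′+w ⟨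
    s       ≤⟨ s≤s′ ⟩
    s′      ≡⟨ +-identityʳ s′ ⟨
    s′ + 0  ∎))
    where open ≤-Reasoning

+-mono-≤-equality : ∀ {a b c d} → a ≤ b → c ≤ d → a + c ≡ b + d → a ≡ b × c ≡ d
+-mono-≤-equality {a} {b} {c} {d} a≤b c≤d a+c≡b+d = a≡b , +-cancelˡ-≡ a c d (trans a+c≡b+d (cong (_+ d) (sym a≡b)))
  where
  a≡b : a ≡ b
  a≡b = ≤-antisym a≤b (+-cancelʳ-≤ c b a (≤-trans (+-monoʳ-≤ b c≤d) (≤-reflexive (sym a+c≡b+d))))

telescope : ∀ {c′ c s₂ s₁ w x y x′ y′} →
            2 * c′ ≡ s₂ + 2 * w → s₂ + 2 * y ≡ s₁ + 2 * y′ → s₁ + 2 * x ≡ 2 * c + 2 * x′ →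
            c′ + (x + y) ≡ c + ((x′ + y′) + w)
telescope {c′} {c} {s₂} {s₁} {w} {x} {y} {x′} {y′} e₁ e₂ e₃ =
  *-cancelˡ-≡ _ _ 2 (+-cancelˡ-≡ (s₂ + s₁) _ _ (begin
    (s₂ + s₁) + 2 * (c′ + (x + y))                     ≡⟨ solve (s₂ ∷ s₁ ∷ c′ ∷ x ∷ y ∷ []) ⟩
    (2 * c′ + (s₂ + 2 * y)) + (s₁ + 2 * x)             ≡⟨ cong₂ _+_ (cong₂ _+_ e₁ e₂) e₃ ⟩
    ((s₂ + 2 * w) + (s₁ + 2 * y′)) + (2 * c + 2 * x′)  ≡⟨ solve (s₂ ∷ s₁ ∷ c ∷ w ∷ x′ ∷ y′ ∷ []) ⟩
    (s₂ + s₁) + 2 * (c + ((x′ + y′) + w))              ∎))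
  where open ≡-Reasoning

-- Arc sums

arcTerm : ∀ {n} → (Fin n → Fin n → Bool) → (Fin n → ℕ) → Fin n → Fin n → ℕ
arcTerm A δ x y = if A x y then sqGap (δ x) (δ y) else 0

arcSum : ∀ {n} → (Fin n → Fin n → Bool) → (Fin n → ℕ) → ℕ
arcSum {n} A δ = sumFin n (λ x → sumFin n (arcTerm A δ x))

arcSum-cong : ∀ {n} (A : Fin n → Fin n → Bool) {δ δ′ : Fin n → ℕ} → (∀ x → δ x ≡ δ′ x) → arcSum A δ ≡ arcSum A δ′
arcSum-cong {n} A δ≗δ′ = sumFin-cong n (λ x → sumFin-cong n (λ y →
  cong (λ t → if A x y then t else 0) (cong₂ sqGap (δ≗δ′ x) (δ≗δ′ y))))

adj-sqGap-sym : ∀ {n} (G : SimpleGraph n) x y p q →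
                (if adj G x y then sqGap p q else 0) ≡ (if adj G y x then sqGap q p else 0)
adj-sqGap-sym G x y p q = cong₂ (λ b t → if b then t else 0) (SimpleGraph.sym G x y) (sqGap-comm p q)

arcTerm-loop : ∀ {n} (G : SimpleGraph n) δ x → arcTerm (adj G) δ x x ≡ 0
arcTerm-loop G δ x = cong (λ b → if b then _ else 0) (loopless G x)

cM2-double : ∀ {n} (G : SimpleGraph n) → 2 * cM2 G ≡ arcSum (adj G) (deg G)
cM2-double {n} G = begin
  2 * cM2 G
    ≡⟨ cong (2 *_) (sumFin-cong n (λ x → sumFin-cong n (λ y → if-∧ (adj G x y) (toℕ x <ᵇ toℕ y) _))) ⟩
  2 * sumFin n (λ x → sumFin n (λ y → if toℕ x <ᵇ toℕ y then arcTerm (adj G) (deg G) x y else 0))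
    ≡⟨ upperTriangle-double n (arcTerm (adj G) (deg G))
                            (λ x y → adj-sqGap-sym G x y (deg G x) (deg G y)) (arcTerm-loop G (deg G)) ⟩
  arcSum (adj G) (deg G) ∎
  where open ≡-Reasoning

bump : ∀ {n} → (Fin n → ℕ) → Fin n → Fin n → ℕ
bump δ z x = (if ⌊ x ≟ z ⌋ then 1 else 0) + δ x

bump-self : ∀ {n} (δ : Fin n → ℕ) z → bump δ z z ≡ suc (δ z)
bump-self δ z rewrite ≡-≟-identity _≟_ (refl {x = z}) = refl

bump-other : ∀ {n} (δ : Fin n → ℕ) {z x} → x ≢ z → bump δ z x ≡ δ x
bump-other δ x≢z rewrite ≢-≟-identity _≟_ x≢z = refl

-- With δ = deg G, countAbove is d_F⁻ (inDeg), while countNotAbove counts the out-arcs and the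
-- undirected edges of F at z.
countAbove countNotAbove : ∀ {n} → SimpleGraph n → (Fin n → ℕ) → Fin n → ℕ
countAbove    {n} G δ z = countFin n (λ y → adj G z y ∧ (δ z <ᵇ δ y))
countNotAbove {n} G δ z = countFin n (λ y → adj G z y ∧ not (δ z <ᵇ δ y))

neighbourCounts-local : ∀ {n} (G : SimpleGraph n) {δ δ′ : Fin n → ℕ} z →
                        δ z ≡ δ′ z → (∀ y → adj G z y ≡ true → δ y ≡ δ′ y) →
                        countAbove G δ z ≡ countAbove G δ′ z × countNotAbove G δ z ≡ countNotAbove G δ′ z
neighbourCounts-local {n} G {δ} {δ′} z δz≡δ′z δ≗δ′ = countFin-∧-cong n <ᵇ-agrees
                                                  , countFin-∧-cong n (λ y zy∈G → cong not (<ᵇ-agrees y zy∈G))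
  where
  <ᵇ-agrees : ∀ y → adj G z y ≡ true → (δ z <ᵇ δ y) ≡ (δ′ z <ᵇ δ′ y)
  <ᵇ-agrees y zy∈G = cong₂ _<ᵇ_ δz≡δ′z (δ≗δ′ y zy∈G)

module _ {n} (G : SimpleGraph n) (δ : Fin n → ℕ) (z : Fin n) where
  private
    k : ℕ
    k = suc (δ z + δ z)
    above notAbove : Fin n → ℕ
    above    y = if adj G z y ∧ (δ z <ᵇ δ y) then k else 0
    notAbove y = if adj G z y ∧ not (δ z <ᵇ δ y) then k else 0
    star : (Fin n → ℕ) → Fin n → Fin n → ℕ
    star g x y = (if ⌊ x ≟ z ⌋ then g y else 0) + (if ⌊ y ≟ z ⌋ then g x else 0)

    arcTerm-bump : ∀ x y → arcTerm (adj G) (bump δ z) x y + star above x y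
                           ≡ arcTerm (adj G) δ x y + star notAbove x y
    arcTerm-bump x y with x ≟ z | y ≟ z
    ... | yes refl | yes refl rewrite loopless G z = refl
    ... | yes refl | no _ rewrite +-identityʳ (above y) | +-identityʳ (notAbove y) =
      edge-sqGap-suc (adj G z y) (δ z) (δ y)
    ... | no _     | yes refl = begin
      (if adj G x z then sqGap (δ x) (suc (δ z)) else 0) + above x
        ≡⟨ cong (_+ above x) (adj-sqGap-sym G x z (δ x) (suc (δ z))) ⟩
      (if adj G z x then sqGap (suc (δ z)) (δ x) else 0) + above x
        ≡⟨ edge-sqGap-suc (adj G z x) (δ z) (δ x) ⟩
      (if adj G z x then sqGap (δ z) (δ x) else 0) + notAbove x
        ≡⟨ cong (_+ notAbove x) (adj-sqGap-sym G z x (δ z) (δ x)) ⟩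
      (if adj G x z then sqGap (δ x) (δ z) else 0) + notAbove x ∎
      where open ≡-Reasoning
    ... | no _     | no _ = refl

  arcSum-bump : arcSum (adj G) (bump δ z) + 2 * (suc (δ z + δ z) * countAbove G δ z)
                ≡ arcSum (adj G) δ + 2 * (suc (δ z + δ z) * countNotAbove G δ z)
  arcSum-bump = begin
    arcSum (adj G) (bump δ z) + 2 * (k * countAbove G δ z)
      ≡⟨ cong (λ t → arcSum (adj G) (bump δ z) + 2 * t) (sumFin-if-const n _ k) ⟨
    arcSum (adj G) (bump δ z) + 2 * sumFin n above
      ≡⟨ cong (arcSum (adj G) (bump δ z) +_) (sumFin²-star n z above) ⟨
    arcSum (adj G) (bump δ z) + sumFin n (λ x → sumFin n (λ y → star above x y))
      ≡⟨ sumFin²-distrib-+ n _ _ ⟨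
    sumFin n (λ x → sumFin n (λ y → arcTerm (adj G) (bump δ z) x y + star above x y))
      ≡⟨ sumFin-cong n (λ x → sumFin-cong n (arcTerm-bump x)) ⟩
    sumFin n (λ x → sumFin n (λ y → arcTerm (adj G) δ x y + star notAbove x y))
      ≡⟨ sumFin²-distrib-+ n _ _ ⟩
    arcSum (adj G) δ + sumFin n (λ x → sumFin n (λ y → star notAbove x y))
      ≡⟨ cong (arcSum (adj G) δ +_) (sumFin²-star n z notAbove) ⟩
    arcSum (adj G) δ + 2 * sumFin n notAbove
      ≡⟨ cong (λ t → arcSum (adj G) δ + 2 * t) (sumFin-if-const n _ k) ⟩
    arcSum (adj G) δ + 2 * (k * countNotAbove G δ z) ∎
    where open ≡-Reasoning

-- Adding the edge uv

module _ {n} (G : SimpleGraph n) {u v : Fin n} (u≢v : u ≢ v) (u≁v : ¬ Adjacent G u v) where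
  private
    v≢u : v ≢ u
    v≢u = u≢v ∘ sym

    adj-isUV-disjoint : ∀ x y → adj G x y ≡ true → isUV u v x y ≡ false
    adj-isUV-disjoint x y xy∈G with x ≟ u | y ≟ v | x ≟ v | y ≟ u
    ... | yes refl | yes refl | _        | _        = contradiction xy∈G u≁v
    ... | _        | _        | yes refl | yes refl = contradiction (trans (SimpleGraph.sym G u v) xy∈G) u≁v
    ... | yes _    | no _     | yes _    | no _     = refl
    ... | yes _    | no _     | no _     | _        = refl
    ... | no _     | _        | yes _    | no _     = refl
    ... | no _     | _        | no _     | _        = refl

    sumFin-isUV : ∀ x (g : Fin n → ℕ) → sumFin n (λ y → if isUV u v x y then g y else 0)
                  ≡ (if ⌊ x ≟ u ⌋ then g v else 0) + (if ⌊ x ≟ v ⌋ then g u else 0)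
    sumFin-isUV x g = trans (sumFin-if-∨ n _ _ g disjoint)
                            (cong₂ _+_ (sumFin-if-∧-≟ n ⌊ x ≟ u ⌋ v g) (sumFin-if-∧-≟ n ⌊ x ≟ v ⌋ u g))
      where
      disjoint : ∀ y → ⌊ x ≟ u ⌋ ∧ ⌊ y ≟ v ⌋ ≡ true → ⌊ x ≟ v ⌋ ∧ ⌊ y ≟ u ⌋ ≡ false
      disjoint y with x ≟ u | x ≟ v
      ... | yes refl | yes u≡v = contradiction u≡v u≢v
      ... | yes _    | no _    = λ _ → refl
      ... | no _     | _       = λ ()

    G′ : SimpleGraph n
    G′ = addEdge G u v u≢v

    deg-addEdge : ∀ x → deg G′ x ≡ bump (bump (deg G) u) v x
    deg-addEdge x = begin
      deg G′ x                                                  ≡⟨ sumFin-if-∨ n _ _ _ (adj-isUV-disjoint x) ⟩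
      deg G x + sumFin n (λ y → if isUV u v x y then 1 else 0)  ≡⟨ cong (deg G x +_) (sumFin-isUV x _) ⟩
      deg G x + (indicator u + indicator v)                     ≡⟨ rotate (deg G x) (indicator u) (indicator v) ⟩
      indicator v + (indicator u + deg G x)                     ∎
      where
      open ≡-Reasoning
      indicator : Fin n → ℕ
      indicator z = if ⌊ x ≟ z ⌋ then 1 else 0
      rotate : ∀ a b c → a + (b + c) ≡ c + (b + a)
      rotate = solve-∀

    arcSum-addEdge : ∀ δ → arcSum (adj G′) δ ≡ arcSum (adj G) δ + 2 * sqGap (δ u) (δ v)
    arcSum-addEdge δ = begin
      arcSum (adj G′) δ
        ≡⟨ sumFin-cong n (λ x → sumFin-if-∨ n _ _ _ (adj-isUV-disjoint x)) ⟩
      sumFin n (λ x → sumFin n (arcTerm (adj G) δ x) + sumFin n (arcTerm (isUV u v) δ x))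
        ≡⟨ sumFin-distrib-+ n _ _ ⟩
      arcSum (adj G) δ + arcSum (isUV u v) δ
        ≡⟨ cong (arcSum (adj G) δ +_) (trans (sumFin-cong n (λ x → sumFin-isUV x _)) (sumFin-distrib-+ n _ _)) ⟩
      arcSum (adj G) δ + (sumFin n (λ x → if ⌊ x ≟ u ⌋ then sqGap (δ x) (δ v) else 0)
                          + sumFin n (λ x → if ⌊ x ≟ v ⌋ then sqGap (δ x) (δ u) else 0))
        ≡⟨ cong (arcSum (adj G) δ +_) (cong₂ _+_ (sumFin-if-≟ n u _) (sumFin-if-≟ n v _)) ⟩
      arcSum (adj G) δ + (sqGap (δ u) (δ v) + sqGap (δ v) (δ u))
        ≡⟨ cong (λ t → arcSum (adj G) δ + (sqGap (δ u) (δ v) + t))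
                (trans (sqGap-comm (δ v) (δ u)) (sym (+-identityʳ _))) ⟩
      arcSum (adj G) δ + 2 * sqGap (δ u) (δ v) ∎
      where open ≡-Reasoning

    d d₁ d₂ : Fin n → ℕ
    d  = deg G
    d₁ = bump d u
    d₂ = bump d₁ v

    a b : ℕ
    a = deg G u
    b = deg G v

    arcSum-d₂ : 2 * cM2 G′ ≡ arcSum (adj G) d₂ + 2 * sqGap (suc a) (suc b)
    arcSum-d₂ = begin
      2 * cM2 G′                                    ≡⟨ cM2-double G′ ⟩
      arcSum (adj G′) (deg G′)                      ≡⟨ arcSum-cong (adj G′) deg-addEdge ⟩
      arcSum (adj G′) d₂                            ≡⟨ arcSum-addEdge d₂ ⟩
      arcSum (adj G) d₂ + 2 * sqGap (d₂ u) (d₂ v)   ≡⟨ cong (λ t → arcSum (adj G) d₂ + 2 * t)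
                                                             (cong₂ sqGap d₂u d₂v) ⟩
      arcSum (adj G) d₂ + 2 * sqGap (suc a) (suc b) ∎
      where
      open ≡-Reasoning
      d₂u : d₂ u ≡ suc a
      d₂u = trans (bump-other d₁ u≢v) (bump-self d u)
      d₂v : d₂ v ≡ suc b
      d₂v = trans (bump-self d₁ v) (cong suc (bump-other d v≢u))

    bump-v : arcSum (adj G) d₂ + 2 * (suc (b + b) * inDeg G v)
             ≡ arcSum (adj G) d₁ + 2 * (suc (b + b) * countNotAbove G d v)
    bump-v = begin
      arcSum (adj G) d₂ + 2 * (suc (b + b) * inDeg G v)
        ≡⟨ cong₂ (λ m c → arcSum (adj G) d₂ + 2 * (suc (m + m) * c)) d₁v≡b above≡ ⟨
      arcSum (adj G) d₂ + 2 * (suc (d₁ v + d₁ v) * countAbove G d₁ v)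
        ≡⟨ arcSum-bump G d₁ v ⟩
      arcSum (adj G) d₁ + 2 * (suc (d₁ v + d₁ v) * countNotAbove G d₁ v)
        ≡⟨ cong₂ (λ m c → arcSum (adj G) d₁ + 2 * (suc (m + m) * c)) d₁v≡b notAbove≡ ⟩
      arcSum (adj G) d₁ + 2 * (suc (b + b) * countNotAbove G d v) ∎
      where
      open ≡-Reasoning
      d₁v≡b : d₁ v ≡ b
      d₁v≡b = bump-other d v≢u
      neighbours-unbumped : ∀ y → adj G v y ≡ true → d₁ y ≡ d y
      neighbours-unbumped y vy∈G = bump-other d λ { refl → u≁v (trans (SimpleGraph.sym G u v) vy∈G) }
      above≡ : countAbove G d₁ v ≡ inDeg G v
      above≡ = proj₁ (neighbourCounts-local G v d₁v≡b neighbours-unbumped)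
      notAbove≡ : countNotAbove G d₁ v ≡ countNotAbove G d v
      notAbove≡ = proj₂ (neighbourCounts-local G v d₁v≡b neighbours-unbumped)

    bump-u : arcSum (adj G) d₁ + 2 * (suc (a + a) * inDeg G u)
             ≡ 2 * cM2 G + 2 * (suc (a + a) * countNotAbove G d u)
    bump-u = trans (arcSum-bump G d u)
                   (cong (_+ 2 * (suc (a + a) * countNotAbove G d u)) (sym (cM2-double G)))

  cM2-addEdge-balance :
    cM2 G′ + (suc (a + a) * inDeg G u + suc (b + b) * inDeg G v)
    ≡ cM2 G + ((suc (a + a) * countNotAbove G d u + suc (b + b) * countNotAbove G d v) + sqGap (suc a) (suc b))
  cM2-addEdge-balance =
    telescope {cM2 G′} {cM2 G} {arcSum (adj G) d₂} {arcSum (adj G) d₁} {sqGap (suc a) (suc b)}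
              {suc (a + a) * inDeg G u} {suc (b + b) * inDeg G v}
              {suc (a + a) * countNotAbove G d u} {suc (b + b) * countNotAbove G d v}
              arcSum-d₂ bump-v bump-u

-- In- and out-degrees of F

outDeg≤countNotAbove : ∀ {n} (G : SimpleGraph n) x → outDeg G x ≤ countNotAbove G (deg G) x
outDeg≤countNotAbove {n} G x = countFin-mono n pointwise
  where
  pointwise : ∀ y → adj G x y ∧ (deg G y <ᵇ deg G x) ≡ true → adj G x y ∧ not (deg G x <ᵇ deg G y) ≡ true
  pointwise y with adj G x y
  ... | true  = <ᵇ-asym (deg G y) (deg G x)
  ... | false = λ ()

inDeg≤countNotAbove : ∀ {n} (G : SimpleGraph n) {x} →
                      outDeg G x ≥ inDeg G x → inDeg G x ≤ countNotAbove G (deg G) x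
inDeg≤countNotAbove G {x} in≤out = ≤-trans in≤out (outDeg≤countNotAbove G x)

inDeg≡countNotAbove⇒outDeg≡inDeg : ∀ {n} (G : SimpleGraph n) {x} → outDeg G x ≥ inDeg G x →
                                   inDeg G x ≡ countNotAbove G (deg G) x → outDeg G x ≡ inDeg G x
inDeg≡countNotAbove⇒outDeg≡inDeg G {x} in≤out in≡notAbove =
  ≤-antisym (≤-trans (outDeg≤countNotAbove G x) (≤-reflexive (sym in≡notAbove))) in≤out

mainTheorem2 : ∀ {n} (G : SimpleGraph n) (u v : Fin n)
    → outDeg G u ≥ inDeg G u
    → outDeg G v ≥ inDeg G v
    → (u≢v : u ≢ v)
    → ¬ Adjacent G u v
    → (cM2 (addEdge G u v u≢v) ≥ cM2 G)
      × (cM2 (addEdge G u v u≢v) ≡ cM2 G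
         → deg G u ≡ deg G v × outDeg G u ≡ inDeg G u × outDeg G v ≡ inDeg G v)
mainTheorem2 G u v in≤out-u in≤out-v u≢v u≁v =
  balance⇒≤ (cM2-addEdge-balance G u≢v u≁v) weights≤ , equality
  where
  ka kb : ℕ
  ka = suc (deg G u + deg G u)
  kb = suc (deg G v + deg G v)
  u-weight≤ : ka * inDeg G u ≤ ka * countNotAbove G (deg G) u
  u-weight≤ = *-monoʳ-≤ ka (inDeg≤countNotAbove G in≤out-u)
  v-weight≤ : kb * inDeg G v ≤ kb * countNotAbove G (deg G) v
  v-weight≤ = *-monoʳ-≤ kb (inDeg≤countNotAbove G in≤out-v)
  weights≤ : ka * inDeg G u + kb * inDeg G v ≤ ka * countNotAbove G (deg G) u + kb * countNotAbove G (deg G) v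
  weights≤ = +-mono-≤ u-weight≤ v-weight≤
  equality : cM2 (addEdge G u v u≢v) ≡ cM2 G →
             deg G u ≡ deg G v × outDeg G u ≡ inDeg G u × outDeg G v ≡ inDeg G v
  equality same with balance⇒≡ (cM2-addEdge-balance G u≢v u≁v) weights≤ same
  ... | gap≡0 , weights≡ with +-mono-≤-equality u-weight≤ v-weight≤ weights≡
  ... | u-tight , v-tight = suc-injective (sqGap≡0⇒≡ gap≡0)
                          , inDeg≡countNotAbove⇒outDeg≡inDeg G in≤out-u (*-cancelˡ-≡ _ _ ka u-tight)
                          , inDeg≡countNotAbove⇒outDeg≡inDeg G in≤out-v (*-cancelˡ-≡ _ _ kb v-tight)
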